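{- Let $D$ be a digraph of order $n$ with minimum in-degree $\delta^-$, maximum in-degree $\Delta^-$ and maximum out-degree $\Delta^+$, and let $k\in\{2-\Delta^-,\dots,\Delta^-\}$ be an integer. Then $$\gamma_k^o(D)\ge \left(\frac{k+\delta^- }{2\Delta^++\delta^-+k}\right)n.$$ Moreover, when $k=1$, equality holds if and only if $D\in\Phi$.
   Context: All digraphs are finite, without loops or multiple arcs (pairs of opposite arcs allowed). For a digraph $D$ and $S\subseteq V(D)$, $\overline{S}=V(D)\setminus S$, $deg^-_S(v)$ is the number of in-neighbors of $v$ lying in $S$, and $N^+[S]$ is $S$ together with all vertices having an in-neighbor in $S$. For $k\in\{2-\Delta^-(D),\dots,\Delta^-(D)\}$, a set $S\subseteq V(D)$ is a global offensive $k$-alliance of $D$ if $N^+[S]=V(D)$ and $deg^-_S(v)\ge deg^-_{\overline{S}}(v)+k$ for every $v\in\overline{S}$; $\gamma_k^o(D)$ is the minimum cardinality of such a set. The family $\Phi$: take positive integers $n',p$, a nonnegative integer $r'$, and a digraph $\widehat{D}$ with vertex set $\{v_1,\dots,v_{n'},u_1,\dots,u_p\}$ such that (i) $(r'+1)n'\equiv 0 \pmod p$ and $(r'+1)n'/p\ge deg^+_{\widehat D}(v_i)$ for each $1\le i\le n'$; (ii) every $v_i$ has in-degree exactly $r'$ in the subdigraph of $\widehat D$ induced by $\{v_1,\dots,v_{n'}\}$; (iii) $deg^+_{\widehat D}(u_i)=0$ and $deg^-_{\widehat D}(u_i)\ge 2r'+1$ for each $1\le i\le p$. Then add, from each $u_i$,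 exactly $r=(r'+1)n'/p$ arcs to vertices of $\{v_1,\dots,v_{n'}\}$, in such a way that every $v_j$ receives exactly $r'+1$ of these new arcs. $\Phi$ is the family of all digraphs obtained in this way. -}

module Defs where

open import Data.Nat using (ℕ; zero; suc; _+_; _*_; _≤_; _⊓_; _⊔_)
open import Data.Bool using (Bool; true; false; _∧_; _∨_; if_then_else_)
open import Data.Fin using (Fin; zero; suc)
open import Data.Fin.Subset using (Subset; _∈_; _∉_; ∁; ∣_∣)
open import Data.Vec using (lookup)
open import Data.Integer as ℤ using (ℤ; +_)
open import Data.Product using (Σ; ∃; _×_; _,_)
open import Data.Sum using (_⊎_)
open import Function using (_∘_)
open import Relation.Binary.PropositionalEquality using (_≡_)

-- Arc relations on the vertex set Fin n (true = there is an arc x → y).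
Arcs : ℕ → Set
Arcs n = Fin n → Fin n → Bool

-- A digraph of order n: no loops; no multiple arcs automatically
-- (arcs form a relation); opposite arcs are allowed.
record Digraph (n : ℕ) : Set where
  field
    arc      : Arcs n
    loopless : ∀ i → arc i i ≡ false
open Digraph public

count : ∀ {n} → (Fin n → Bool) → ℕ
count {zero}  f = 0
count {suc n} f = (if f zero then 1 else 0) + count (f ∘ suc)

-- maximum / minimum of a function on Fin n (0 for n = 0)
maxF : ∀ {n} → (Fin n → ℕ) → ℕ
maxF {zero}  f = 0
maxF {suc n} f = f zero ⊔ maxF (f ∘ suc)

min1 : ∀ n → (Fin (suc n) → ℕ) → ℕ
min1 zero    f = f zero
min1 (suc n) f = f zero ⊓ min1 n (f ∘ suc)

minF : ∀ {n} → (Fin n → ℕ) → ℕ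
minF {zero}  f = 0
minF {suc n} f = min1 n f

degInFrom : ∀ {n} → Arcs n → Subset n → Fin n → ℕ
degInFrom a S v = count (λ u → lookup S u ∧ a u v)

inDeg : ∀ {n} → Arcs n → Fin n → ℕ
inDeg a v = count (λ u → a u v)

outDeg : ∀ {n} → Arcs n → Fin n → ℕ
outDeg a v = count (λ w → a v w)

δ⁻ Δ⁻ Δ⁺ : ∀ {n} → Digraph n → ℕ
δ⁻ D = minF (inDeg (arc D))
Δ⁻ D = maxF (inDeg (arc D))
Δ⁺ D = maxF (outDeg (arc D))

IsGlobalOffensiveAlliance : ∀ {n} → Digraph n → ℤ → Subset n → Set
IsGlobalOffensiveAlliance D k S =
  (∀ v → v ∈ S ⊎ ∃ λ u → u ∈ S × arc D u v ≡ true)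
  × (∀ v → v ∉ S →
       (+ degInFrom (arc D) (∁ S) v) ℤ.+ k ℤ.≤ + degInFrom (arc D) S v)

IsGammaO : ∀ {n} → Digraph n → ℤ → ℕ → Set
IsGammaO D k m =
  (∃ λ S → IsGlobalOffensiveAlliance D k S × ∣ S ∣ ≡ m)
  × (∀ S → IsGlobalOffensiveAlliance D k S → m ≤ ∣ S ∣)

-- Membership in the family Φ (up to relabelling of vertices):
-- U = {u_1..u_p}, its complement = {v_1..v_n'}, Dhat = the digraph D̂,
-- A = the added arcs from the u_i to the v_j; D = D̂ + A.
record InΦ {n : ℕ} (D : Digraph n) : Set where
  field
    U      : Subset n
    n'≥1   : 1 ≤ ∣ ∁ U ∣
    p≥1    : 1 ≤ ∣ U ∣
    r'     : ℕ
    r      : ℕ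
    -- (r'+1) n' ≡ 0 (mod p) and r = (r'+1) n' / p
    r-def  : r * ∣ U ∣ ≡ suc r' * ∣ ∁ U ∣
    Dhat   : Digraph n
    A      : Arcs n
    out-v  : ∀ v → v ∉ U → outDeg (arc Dhat) v ≤ r
    in-v   : ∀ v → v ∉ U → degInFrom (arc Dhat) (∁ U) v ≡ r'
    out-u  : ∀ u → u ∈ U → outDeg (arc Dhat) u ≡ 0
    in-u   : ∀ u → u ∈ U → 2 * r' + 1 ≤ inDeg (arc Dhat) u
    A-from : ∀ x y → A x y ≡ true → x ∈ U × y ∉ U
    A-out  : ∀ u → u ∈ U → outDeg A u ≡ r
    A-in   : ∀ v → v ∉ U → inDeg A v ≡ suc r'
    D-eq   : ∀ x y → arc D x y ≡ (arc Dhat x y ∨ A x y)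

module Submission where

-- Count the arcs from S to its complement. Each vertex of S sends at most Δ⁺ of
-- them, while a vertex v outside S receives deg⁻_S(v) ≥ (deg⁻(v) + k)/2 ≥ (δ⁻ + k)/2,
-- because S outnumbers the complement among the in-neighbours of v by k. Hence
-- (n − |S|)(δ⁻ + k) ≤ 2 |S| Δ⁺, which is the bound. For k = 1, equality makes both
-- estimates tight: every vertex of S has out-degree Δ⁺ with all out-arcs leaving S,
-- and every v outside S has r' in-neighbours outside S and r' + 1 inside, where
-- δ⁻ = 2r' + 1. Splitting the arcs by whether their tail lies in S exhibits D in Φ.
-- Conversely, in a digraph of Φ the set {u_i} is an offensive 1-alliance, the bound
-- forces every offensive 1-alliance to be at least as large, and its size attains it.

open import Defs

module Counting where

  open import Data.Nat.Properties
  open import Algebra.Properties.Semiring.Sum +-*-semiring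
    using (sum; sum-syntax; sum-cong-≗; ∑-comm; *-distribˡ-sum)
  open import Data.Bool using (Bool; true; false; not; _∧_; if_then_else_)
  open import Data.Fin using (Fin; zero; suc)
  open import Data.Integer as ℤ using (ℤ; +_)
  import Data.Integer.Properties as ℤₚ
  open import Data.Nat using (ℕ; zero; suc; _+_; _*_; _≤_; _<_; _⊔_; _⊓_; z≤n; s≤s)
  open import Data.Product using (∃; _,_)
  open import Function using (_∘_)
  open import Relation.Binary.PropositionalEquality

  sumWhere : ∀ {n} → (Fin n → Bool) → (Fin n → ℕ) → ℕ
  sumWhere {n} P f = ∑[ i < n ] (if P i then f i else 0)

  count≡sumWhere : ∀ {n} (P : Fin n → Bool) → count P ≡ sumWhere P (λ _ → 1)
  count≡sumWhere {zero}  P = refl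
  count≡sumWhere {suc n} P = cong (_+_ (if P zero then 1 else 0)) (count≡sumWhere (P ∘ suc))

  sum-mono : ∀ {n} {f g : Fin n → ℕ} → (∀ i → f i ≤ g i) → sum f ≤ sum g
  sum-mono {zero}  f≤g = z≤n
  sum-mono {suc n} f≤g = +-mono-≤ (f≤g zero) (sum-mono (f≤g ∘ suc))

  sum-mono-tight : ∀ {n} {f g : Fin n → ℕ} → (∀ i → f i ≤ g i) → sum g ≤ sum f →
                   ∀ i → f i ≡ g i
  sum-mono-tight {suc n} {f} {g} f≤g ∑g≤∑f = pointwise
    where
    tail≤ : sum (f ∘ suc) ≤ sum (g ∘ suc)
    tail≤ = sum-mono (f≤g ∘ suc)
    head≥ : g zero ≤ f zero
    head≥ = +-cancelʳ-≤ _ _ _ (≤-trans ∑g≤∑f (+-monoʳ-≤ (f zero) tail≤))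
    tail≥ : sum (g ∘ suc) ≤ sum (f ∘ suc)
    tail≥ = +-cancelˡ-≤ (f zero) _ _ (≤-trans (+-monoˡ-≤ _ (f≤g zero)) ∑g≤∑f)
    pointwise : ∀ i → f i ≡ g i
    pointwise zero    = ≤-antisym (f≤g zero) head≥
    pointwise (suc i) = sum-mono-tight (f≤g ∘ suc) tail≥ i

  restrict-mono : ∀ {n} (P : Fin n → Bool) {f g : Fin n → ℕ} →
                  (∀ i → P i ≡ true → f i ≤ g i) →
                  ∀ i → (if P i then f i else 0) ≤ (if P i then g i else 0)
  restrict-mono P f≤g i with P i in Pi
  ... | true  = f≤g i Pi
  ... | false = z≤n

  sumWhere-mono : ∀ {n} (P : Fin n → Bool) {f g : Fin n → ℕ} →
                  (∀ i → P i ≡ true → f i ≤ g i) → sumWhere P f ≤ sumWhere P g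
  sumWhere-mono P f≤g = sum-mono (restrict-mono P f≤g)

  sumWhere-mono-tight : ∀ {n} (P : Fin n → Bool) {f g : Fin n → ℕ} →
                        (∀ i → P i ≡ true → f i ≤ g i) → sumWhere P g ≤ sumWhere P f →
                        ∀ i → P i ≡ true → f i ≡ g i
  sumWhere-mono-tight P f≤g ∑g≤∑f i Pi
    with sum-mono-tight (restrict-mono P f≤g) ∑g≤∑f i
  ... | fi≡gi rewrite Pi = fi≡gi

  sumWhere-const : ∀ {n} (P : Fin n → Bool) c → sumWhere P (λ _ → c) ≡ count P * c
  sumWhere-const {zero}  P c = refl
  sumWhere-const {suc n} P c with P zero
  ... | true  = cong (_+_ c) (sumWhere-const (P ∘ suc) c)
  ... | false = sumWhere-const (P ∘ suc) c

  sumWhere-*ˡ : ∀ {n} (P : Fin n → Bool) c (f : Fin n → ℕ) →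
                sumWhere P (λ i → c * f i) ≡ c * sumWhere P f
  sumWhere-*ˡ P c f = trans (sum-cong-≗ pointwise) (sym (*-distribˡ-sum c (λ i → if P i then f i else 0)))
    where
    pointwise : ∀ i → (if P i then c * f i else 0) ≡ c * (if P i then f i else 0)
    pointwise i with P i
    ... | true  = refl
    ... | false = sym (*-zeroʳ c)

  count*c≤sumWhere : ∀ {n} (P : Fin n → Bool) (f : Fin n → ℕ) (c : ℤ) →
                    (∀ i → P i ≡ true → c ℤ.≤ + f i) →
                    + count P ℤ.* c ℤ.≤ + sumWhere P f
  count*c≤sumWhere {zero}  P f c c≤f = ℤₚ.≤-refl
  count*c≤sumWhere {suc n} P f c c≤f with P zero in P0
  ... | false = count*c≤sumWhere (P ∘ suc) (f ∘ suc) c (c≤f ∘ suc)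
  ... | true  = begin
    + suc (count (P ∘ suc)) ℤ.* c                ≡⟨ ℤₚ.suc-* (+ count (P ∘ suc)) c ⟩
    c ℤ.+ + count (P ∘ suc) ℤ.* c                ≤⟨ ℤₚ.+-mono-≤ (c≤f zero P0) rest ⟩
    + f zero ℤ.+ + sumWhere (P ∘ suc) (f ∘ suc)  ≡⟨ ℤₚ.pos-+ (f zero) _ ⟨
    + (f zero + sumWhere (P ∘ suc) (f ∘ suc))    ∎
    where
    open ℤₚ.≤-Reasoning
    rest : + count (P ∘ suc) ℤ.* c ℤ.≤ + sumWhere (P ∘ suc) (f ∘ suc)
    rest = count*c≤sumWhere (P ∘ suc) (f ∘ suc) c (c≤f ∘ suc)

  iverson-mono : ∀ {b c : Bool} → (b ≡ true → c ≡ true) → (if b then 1 else 0) ≤ (if c then 1 else 0)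
  iverson-mono {false}         b⇒c = z≤n
  iverson-mono {true}  {true}  b⇒c = ≤-refl
  iverson-mono {true}  {false} b⇒c with b⇒c refl
  ... | ()

  count-cong : ∀ {n} {P Q : Fin n → Bool} → (∀ i → P i ≡ Q i) → count P ≡ count Q
  count-cong {zero}              P≗Q = refl
  count-cong {suc n} {P} {Q} P≗Q rewrite P≗Q zero = cong (_+_ (if Q zero then 1 else 0)) (count-cong (P≗Q ∘ suc))

  count-mono : ∀ {n} {P Q : Fin n → Bool} → (∀ i → P i ≡ true → Q i ≡ true) → count P ≤ count Q
  count-mono {P = P} {Q} P⊆Q = subst₂ _≤_ (sym (count≡sumWhere P)) (sym (count≡sumWhere Q))
    (sum-mono (λ i → iverson-mono (P⊆Q i)))

  count-mono-tight : ∀ {n} {P Q : Fin n → Bool} → (∀ i → P i ≡ true → Q i ≡ true) →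
                     count Q ≤ count P → ∀ i → Q i ≡ true → P i ≡ true
  count-mono-tight {P = P} {Q} P⊆Q #Q≤#P i Qi
    with sum-mono-tight (λ i → iverson-mono (P⊆Q i))
           (subst₂ _≤_ (count≡sumWhere Q) (count≡sumWhere P) #Q≤#P) i
  ... | ι[Pi]≡ι[Qi] rewrite Qi with P i
  ...   | true  = refl
  ...   | false with () ← ι[Pi]≡ι[Qi]

  count-partition : ∀ {n} (P Q : Fin n → Bool) →
                    count Q ≡ count (λ i → P i ∧ Q i) + count (λ i → not (P i) ∧ Q i)
  count-partition {zero}  P Q = refl
  count-partition {suc n} P Q with P zero | Q zero | count-partition (P ∘ suc) (Q ∘ suc)
  ... | true  | true  | rest = cong suc rest
  ... | true  | false | rest = rest
  ... | false | true  | rest = trans (cong suc rest) (sym (+-suc _ _))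
  ... | false | false | rest = rest

  count-none : ∀ {n} (P : Fin n → Bool) → (∀ i → P i ≡ false) → count P ≡ 0
  count-none {zero}  P none = refl
  count-none {suc n} P none rewrite none zero = count-none (P ∘ suc) (none ∘ suc)

  count≡0⇒none : ∀ {n} (P : Fin n → Bool) → count P ≡ 0 → ∀ i → P i ≡ false
  count≡0⇒none {suc n} P #P≡0 i with P zero in P0
  count≡0⇒none {suc n} P #P≡0 zero    | false = P0
  count≡0⇒none {suc n} P #P≡0 (suc i) | false = count≡0⇒none (P ∘ suc) #P≡0 i

  count-pos⇒∃ : ∀ {n} (P : Fin n → Bool) → 0 < count P → ∃ λ i → P i ≡ true
  count-pos⇒∃ {suc n} P 0<#P with P zero in P0
  ... | true  = zero , P0
  ... | false with count-pos⇒∃ (P ∘ suc) 0<#P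
  ...   | i , Pi = suc i , Pi

  ∃⇒count-pos : ∀ {n} (P : Fin n → Bool) i → P i ≡ true → 0 < count P
  ∃⇒count-pos P zero    Pi rewrite Pi = s≤s z≤n
  ∃⇒count-pos P (suc i) Pi = ≤-trans (∃⇒count-pos (P ∘ suc) i Pi) (m≤n+m _ _)

  maxF-ub : ∀ {n} (f : Fin n → ℕ) i → f i ≤ maxF f
  maxF-ub f zero    = m≤m⊔n _ _
  maxF-ub f (suc i) = ≤-trans (maxF-ub (f ∘ suc) i) (m≤n⊔m _ _)

  maxF-lub : ∀ {n} (f : Fin n → ℕ) {c} → (∀ i → f i ≤ c) → maxF f ≤ c
  maxF-lub {zero}  f f≤c = z≤n
  maxF-lub {suc n} f f≤c = ⊔-lub (f≤c zero) (maxF-lub (f ∘ suc) (f≤c ∘ suc))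

  maxF-pos⇒∃ : ∀ {n} (f : Fin n → ℕ) → 0 < maxF f → ∃ λ i → 0 < f i
  maxF-pos⇒∃ {suc n} f 0<max with f zero in f0
  ... | suc _ = zero , subst (0 <_) (sym f0) (s≤s z≤n)
  ... | zero with maxF-pos⇒∃ (f ∘ suc) 0<max
  ...   | i , 0<fi = suc i , 0<fi

  min1-lb : ∀ n (f : Fin (suc n) → ℕ) i → min1 n f ≤ f i
  min1-lb zero    f zero    = ≤-refl
  min1-lb (suc n) f zero    = m⊓n≤m _ _
  min1-lb (suc n) f (suc i) = ≤-trans (m⊓n≤n _ _) (min1-lb n (f ∘ suc) i)

  min1-glb : ∀ n (f : Fin (suc n) → ℕ) {c} → (∀ i → c ≤ f i) → c ≤ min1 n f
  min1-glb zero    f c≤f = c≤f zero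
  min1-glb (suc n) f c≤f = ⊓-glb (c≤f zero) (min1-glb n (f ∘ suc) (c≤f ∘ suc))

  minF-lb : ∀ {n} (f : Fin n → ℕ) i → minF f ≤ f i
  minF-lb {suc n} f i = min1-lb n f i

  minF-glb : ∀ {n} (f : Fin n → ℕ) {c} → Fin n → (∀ i → c ≤ f i) → c ≤ minF f
  minF-glb {suc n} f _ c≤f = min1-glb n f c≤f

  ∑count-comm : ∀ {m n} (R : Fin m → Fin n → Bool) →
                ∑[ i < m ] count (R i) ≡ ∑[ j < n ] count (λ i → R i j)
  ∑count-comm R = begin
    ∑[ i < _ ] count (R i)                              ≡⟨ sum-cong-≗ (λ i → count≡sumWhere (R i)) ⟩
    ∑[ i < _ ] sumWhere (R i) (λ _ → 1)                 ≡⟨ ∑-comm (λ i j → if R i j then 1 else 0) ⟩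
    ∑[ j < _ ] sumWhere (λ i → R i j) (λ _ → 1)         ≡⟨ sum-cong-≗ (λ j → sym (count≡sumWhere (λ i → R i j))) ⟩
    ∑[ j < _ ] count (λ i → R i j)                      ∎
    where open ≡-Reasoning

module Alliance where

  open Counting
  open import Data.Nat.Properties
  open import Algebra.Properties.Semiring.Sum +-*-semiring using (sum-syntax; sum-cong-≗)
  open import Data.Bool using (Bool; true; false; not; _∧_; _∨_; if_then_else_)
  open import Data.Bool.Properties
    using (∧-conicalˡ; ∧-conicalʳ; ∧-zeroʳ; ∧-assoc; ∧-idem; ∨-identityʳ; ∧-commutativeMonoid)
  open import Algebra.Bundles using (CommutativeMonoid)
  open import Algebra.Properties.CommutativeSemigroup (CommutativeMonoid.commutativeSemigroup ∧-commutativeMonoid)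
    using (x∙yz≈y∙xz)
  open import Data.Fin using (Fin)
  open import Data.Fin.Subset using (Subset; Nonempty; _∈_; _∉_; ∁; ∣_∣)
  open import Data.Fin.Subset.Properties using (_∈?_; ∣p∣≤n; ∣∁p∣≡n∸∣p∣; x∈∁p⇒x∉p; x∉p⇒x∈∁p)
  open import Data.Integer as ℤ using (ℤ; +_)
  import Data.Integer.Properties as ℤₚ
  import Data.Integer.Tactic.RingSolver as ℤ-Solver
  open import Data.Nat using (ℕ; zero; suc; _+_; _*_; _≤_; _<_; z≤n; s≤s; NonZero; >-nonZero)
  open import Data.Nat.Tactic.RingSolver using (solve-∀)
  open import Data.Product using (∃; ∃₂; _×_; _,_; proj₁; proj₂)
  open import Data.Vec using ([]; _∷_; lookup)
  open import Data.Vec.Properties using ([]=⇒lookup; lookup⇒[]=; lookup-map)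
  open import Data.Empty using (⊥-elim)
  open import Data.Sum using (_⊎_; inj₁; inj₂)
  open import Function.Bundles using (_⇔_; mk⇔)
  open import Relation.Nullary using (yes; no)
  open import Relation.Binary.PropositionalEquality

  ∣p∣≡count : ∀ {n} (p : Subset n) → ∣ p ∣ ≡ count (lookup p)
  ∣p∣≡count []          = refl
  ∣p∣≡count (true ∷ p)  = cong suc (∣p∣≡count p)
  ∣p∣≡count (false ∷ p) = ∣p∣≡count p

  ∣p∣+∣∁p∣≡n : ∀ {n} (p : Subset n) → ∣ p ∣ + ∣ ∁ p ∣ ≡ n
  ∣p∣+∣∁p∣≡n p = trans (cong (_+_ ∣ p ∣) (∣∁p∣≡n∸∣p∣ p)) (m+[n∸m]≡n (∣p∣≤n p))

  ∣p∣>0⇒Nonempty : ∀ {n} (p : Subset n) → 0 < ∣ p ∣ → Nonempty p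
  ∣p∣>0⇒Nonempty p 0<∣p∣ with count-pos⇒∃ (lookup p) (subst (0 <_) (∣p∣≡count p) 0<∣p∣)
  ... | x , px = x , lookup⇒[]= x p px

  x∈p⇒∣p∣>0 : ∀ {n} {p : Subset n} {x} → x ∈ p → 0 < ∣ p ∣
  x∈p⇒∣p∣>0 {p = p} {x} x∈p = subst (0 <_) (sym (∣p∣≡count p)) (∃⇒count-pos (lookup p) x ([]=⇒lookup x∈p))

  lookup∁ : ∀ {n} (p : Subset n) x → lookup (∁ p) x ≡ not (lookup p x)
  lookup∁ p x = lookup-map x not p

  ∉⇒lookup∁ : ∀ {n} {p : Subset n} {x} → x ∉ p → lookup (∁ p) x ≡ true
  ∉⇒lookup∁ x∉p = []=⇒lookup (x∉p⇒x∈∁p x∉p)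

  lookup∁⇒∉ : ∀ {n} {p : Subset n} {x} → lookup (∁ p) x ≡ true → x ∉ p
  lookup∁⇒∉ {p = p} {x} eq = x∈∁p⇒x∉p (lookup⇒[]= x (∁ p) eq)

  ∉⇒lookup : ∀ {n} {p : Subset n} {x} → x ∉ p → lookup p x ≡ false
  ∉⇒lookup {p = p} {x} x∉p with lookup p x in px
  ... | true  = ⊥-elim (x∉p (lookup⇒[]= x p px))
  ... | false = refl

  ∈⇒lookup∁ : ∀ {n} {p : Subset n} {x} → x ∈ p → lookup (∁ p) x ≡ false
  ∈⇒lookup∁ {p = p} {x} x∈p = trans (lookup∁ p x) (cong not ([]=⇒lookup x∈p))

  if-count : ∀ {n} b (P : Fin n → Bool) → (if b then count P else 0) ≡ count (λ i → b ∧ P i)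
  if-count     true  P = refl
  if-count {n} false P = sym (count-none {n} (λ _ → false) (λ _ → refl))

  outDegTo : ∀ {n} → Arcs n → Subset n → Fin n → ℕ
  outDegTo a T u = count (λ v → lookup T v ∧ a u v)

  outDegTo≤outDeg : ∀ {n} (a : Arcs n) T u → outDegTo a T u ≤ outDeg a u
  outDegTo≤outDeg a T u = count-mono (λ v → ∧-conicalʳ (lookup T v) (a u v))

  degInFrom≤∣S∣ : ∀ {n} (a : Arcs n) S v → degInFrom a S v ≤ ∣ S ∣
  degInFrom≤∣S∣ a S v = subst (degInFrom a S v ≤_) (sym (∣p∣≡count S))
    (count-mono (λ u → ∧-conicalˡ (lookup S u) (a u v)))

  inDeg≡degInFrom+degInFrom∁ : ∀ {n} (a : Arcs n) S v →
                               inDeg a v ≡ degInFrom a S v + degInFrom a (∁ S) v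
  inDeg≡degInFrom+degInFrom∁ a S v = trans (count-partition (lookup S) (λ u → a u v))
    (cong (_+_ (degInFrom a S v)) (count-cong (λ u → cong (_∧ a u v) (sym (lookup∁ S u)))))

  ∑outDegTo≡∑degInFrom : ∀ {n} (a : Arcs n) (S T : Subset n) →
                         sumWhere (lookup S) (outDegTo a T) ≡ sumWhere (lookup T) (degInFrom a S)
  ∑outDegTo≡∑degInFrom {n} a S T = begin
    sumWhere (lookup S) (outDegTo a T)
      ≡⟨ sum-cong-≗ (λ u → if-count (lookup S u) (λ v → lookup T v ∧ a u v)) ⟩
    ∑[ u < n ] count (λ v → lookup S u ∧ (lookup T v ∧ a u v))
      ≡⟨ ∑count-comm (λ u v → lookup S u ∧ (lookup T v ∧ a u v)) ⟩
    ∑[ v < n ] count (λ u → lookup S u ∧ (lookup T v ∧ a u v))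
      ≡⟨ sum-cong-≗ (λ v → count-cong (λ u → x∙yz≈y∙xz (lookup S u) (lookup T v) (a u v))) ⟩
    ∑[ v < n ] count (λ u → lookup T v ∧ (lookup S u ∧ a u v))
      ≡⟨ sum-cong-≗ (λ v → sym (if-count (lookup T v) (λ u → lookup S u ∧ a u v))) ⟩
    sumWhere (lookup T) (degInFrom a S) ∎
    where open ≡-Reasoning

  outDegTo≤Δ⁺ : ∀ {n} (D : Digraph n) T u → outDegTo (arc D) T u ≤ Δ⁺ D
  outDegTo≤Δ⁺ D T u = ≤-trans (outDegTo≤outDeg (arc D) T u) (maxF-ub (outDeg (arc D)) u)

  δ⁻≤degInFrom+degInFrom∁ : ∀ {n} (D : Digraph n) S v →
                            δ⁻ D ≤ degInFrom (arc D) S v + degInFrom (arc D) (∁ S) v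
  δ⁻≤degInFrom+degInFrom∁ D S v =
    ≤-trans (minF-lb (inDeg (arc D)) v) (≤-reflexive (inDeg≡degInFrom+degInFrom∁ (arc D) S v))

  crossArcs : ∀ {n} → Digraph n → Subset n → ℕ
  crossArcs D S = sumWhere (lookup S) (outDegTo (arc D) (∁ S))

  crossArcs≤∣S∣*Δ⁺ : ∀ {n} (D : Digraph n) S → crossArcs D S ≤ ∣ S ∣ * Δ⁺ D
  crossArcs≤∣S∣*Δ⁺ D S = begin
    crossArcs D S                     ≤⟨ sumWhere-mono (lookup S) (λ u _ → outDegTo≤Δ⁺ D (∁ S) u) ⟩
    sumWhere (lookup S) (λ _ → Δ⁺ D)  ≡⟨ sumWhere-const (lookup S) (Δ⁺ D) ⟩
    count (lookup S) * Δ⁺ D           ≡⟨ cong (_* Δ⁺ D) (sym (∣p∣≡count S)) ⟩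
    ∣ S ∣ * Δ⁺ D                      ∎
    where open ≤-Reasoning

  2*crossArcs≡∑2degInFrom : ∀ {n} (D : Digraph n) S →
    2 * crossArcs D S ≡ sumWhere (lookup (∁ S)) (λ v → 2 * degInFrom (arc D) S v)
  2*crossArcs≡∑2degInFrom D S = begin
    2 * crossArcs D S                                       ≡⟨ cong (2 *_) (∑outDegTo≡∑degInFrom (arc D) S (∁ S)) ⟩
    2 * sumWhere (lookup (∁ S)) (degInFrom (arc D) S)       ≡⟨ sumWhere-*ˡ (lookup (∁ S)) 2 (degInFrom (arc D) S) ⟨
    sumWhere (lookup (∁ S)) (λ v → 2 * degInFrom (arc D) S v) ∎
    where open ≡-Reasoning

  alliance⇒δ⁻+k≤2*degInFrom : ∀ {n} (D : Digraph n) {k S} → IsGlobalOffensiveAlliance D k S →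
    ∀ v → v ∉ S → + δ⁻ D ℤ.+ k ℤ.≤ + (2 * degInFrom (arc D) S v)
  alliance⇒δ⁻+k≤2*degInFrom D {k} {S} (_ , outnumbered) v v∉S = begin
    + δ⁻ D ℤ.+ k                       ≤⟨ ℤₚ.+-monoˡ-≤ k (ℤ.+≤+ (δ⁻≤degInFrom+degInFrom∁ D S v)) ⟩
    + (dS + dC) ℤ.+ k                  ≡⟨ ℤₚ.+-assoc (+ dS) (+ dC) k ⟩
    + dS ℤ.+ (+ dC ℤ.+ k)              ≤⟨ ℤₚ.+-monoʳ-≤ (+ dS) (outnumbered v v∉S) ⟩
    + (dS + dS)                        ≡⟨ cong (λ x → + (dS + x)) (+-identityʳ dS) ⟨
    + (2 * dS)                         ∎
    where
    open ℤₚ.≤-Reasoning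
    dS dC : ℕ
    dS = degInFrom (arc D) S v
    dC = degInFrom (arc D) (∁ S) v

  alliance-size-bound : ∀ {n} (D : Digraph n) {k S} → IsGlobalOffensiveAlliance D k S →
    (k ℤ.+ + δ⁻ D) ℤ.* + n ℤ.≤ + ∣ S ∣ ℤ.* (+ 2 ℤ.* + Δ⁺ D ℤ.+ + δ⁻ D ℤ.+ k)
  alliance-size-bound {n} D {k} {S} alliance = begin
    (k ℤ.+ δ) ℤ.* + n                       ≡⟨ cong ((k ℤ.+ δ) ℤ.*_) n≡m+n₁ ⟩
    (k ℤ.+ δ) ℤ.* (m ℤ.+ n₁)                ≡⟨ split k δ m n₁ ⟩
    n₁ ℤ.* (δ ℤ.+ k) ℤ.+ m ℤ.* (δ ℤ.+ k)    ≤⟨ ℤₚ.+-monoˡ-≤ (m ℤ.* (δ ℤ.+ k)) (ℤₚ.≤-trans outside inside) ⟩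
    + 2 ℤ.* (m ℤ.* Δ) ℤ.+ m ℤ.* (δ ℤ.+ k)   ≡⟨ collect m Δ δ k ⟩
    m ℤ.* (+ 2 ℤ.* Δ ℤ.+ δ ℤ.+ k)           ∎
    where
    open ℤₚ.≤-Reasoning
    δ Δ m n₁ : ℤ
    δ  = + δ⁻ D
    Δ  = + Δ⁺ D
    m  = + ∣ S ∣
    n₁ = + ∣ ∁ S ∣
    split : ∀ k δ m n₁ → (k ℤ.+ δ) ℤ.* (m ℤ.+ n₁) ≡ n₁ ℤ.* (δ ℤ.+ k) ℤ.+ m ℤ.* (δ ℤ.+ k)
    split = ℤ-Solver.solve-∀
    collect : ∀ m Δ δ k → + 2 ℤ.* (m ℤ.* Δ) ℤ.+ m ℤ.* (δ ℤ.+ k) ≡ m ℤ.* (+ 2 ℤ.* Δ ℤ.+ δ ℤ.+ k)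
    collect = ℤ-Solver.solve-∀
    n≡m+n₁ : + n ≡ m ℤ.+ n₁
    n≡m+n₁ = trans (cong +_ (sym (∣p∣+∣∁p∣≡n S))) (ℤₚ.pos-+ ∣ S ∣ ∣ ∁ S ∣)
    outside : n₁ ℤ.* (δ ℤ.+ k) ℤ.≤ + (2 * crossArcs D S)
    outside = begin
      n₁ ℤ.* (δ ℤ.+ k)
        ≡⟨ cong (λ x → + x ℤ.* (δ ℤ.+ k)) (∣p∣≡count (∁ S)) ⟩
      + count (lookup (∁ S)) ℤ.* (δ ℤ.+ k)
        ≤⟨ count*c≤sumWhere (lookup (∁ S)) (λ v → 2 * degInFrom (arc D) S v) (δ ℤ.+ k)
             (λ v v∉S → alliance⇒δ⁻+k≤2*degInFrom D {k} alliance v (lookup∁⇒∉ v∉S)) ⟩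
      + sumWhere (lookup (∁ S)) (λ v → 2 * degInFrom (arc D) S v)
        ≡⟨ cong +_ (2*crossArcs≡∑2degInFrom D S) ⟨
      + (2 * crossArcs D S) ∎
    inside : + (2 * crossArcs D S) ℤ.≤ + 2 ℤ.* (m ℤ.* Δ)
    inside = begin
      + (2 * crossArcs D S)      ≤⟨ ℤ.+≤+ (*-monoʳ-≤ 2 (crossArcs≤∣S∣*Δ⁺ D S)) ⟩
      + (2 * (∣ S ∣ * Δ⁺ D))     ≡⟨ ℤₚ.pos-* 2 (∣ S ∣ * Δ⁺ D) ⟩
      + 2 ℤ.* + (∣ S ∣ * Δ⁺ D)   ≡⟨ cong (+ 2 ℤ.*_) (ℤₚ.pos-* ∣ S ∣ (Δ⁺ D)) ⟩
      + 2 ℤ.* (m ℤ.* Δ)          ∎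

  ℤ-lhs₁ : ∀ δ n → (+ 1 ℤ.+ + δ) ℤ.* + n ≡ + ((1 + δ) * n)
  ℤ-lhs₁ δ n = sym (ℤₚ.pos-* (1 + δ) n)

  ℤ-rhs₁ : ∀ m Δ δ → + m ℤ.* (+ 2 ℤ.* + Δ ℤ.+ + δ ℤ.+ + 1) ≡ + (m * (2 * Δ + δ + 1))
  ℤ-rhs₁ m Δ δ = trans (cong (λ x → + m ℤ.* (x ℤ.+ + δ ℤ.+ + 1)) (sym (ℤₚ.pos-* 2 Δ)))
                       (sym (ℤₚ.pos-* m (2 * Δ + δ + 1)))

  ℤ-equation₁⇔ℕ : ∀ m n Δ δ →
    (+ m ℤ.* (+ 2 ℤ.* + Δ ℤ.+ + δ ℤ.+ + 1) ≡ (+ 1 ℤ.+ + δ) ℤ.* + n) ⇔ (m * (2 * Δ + δ + 1) ≡ (1 + δ) * n)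
  ℤ-equation₁⇔ℕ m n Δ δ = mk⇔
    (λ eqℤ → ℤₚ.+-injective (trans (sym (ℤ-rhs₁ m Δ δ)) (trans eqℤ (ℤ-lhs₁ δ n))))
    (λ eqℕ → trans (ℤ-rhs₁ m Δ δ) (trans (cong +_ eqℕ) (sym (ℤ-lhs₁ δ n))))

  2-x≤1⇒0<x : ∀ x → + 2 ℤ.- + x ℤ.≤ + 1 → 0 < x
  2-x≤1⇒0<x zero    (ℤ.+≤+ (s≤s ()))
  2-x≤1⇒0<x (suc x) _ = s≤s z≤n

  alliance-size-bound₁ : ∀ {n} (D : Digraph n) {S} → IsGlobalOffensiveAlliance D (+ 1) S →
    (1 + δ⁻ D) * n ≤ ∣ S ∣ * (2 * Δ⁺ D + δ⁻ D + 1)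
  alliance-size-bound₁ {n} D {S} alliance = ℤₚ.drop‿+≤+
    (subst₂ ℤ._≤_ (ℤ-lhs₁ (δ⁻ D) n) (ℤ-rhs₁ ∣ S ∣ (Δ⁺ D) (δ⁻ D)) (alliance-size-bound D alliance))

  ∃arc : ∀ {n} (D : Digraph n) → 0 < Δ⁻ D → ∃₂ λ u w → arc D u w ≡ true
  ∃arc D 0<Δ⁻ with maxF-pos⇒∃ (inDeg (arc D)) 0<Δ⁻
  ... | w , 0<inDeg with count-pos⇒∃ (λ u → arc D u w) 0<inDeg
  ...   | u , uw = u , w , uw

  arc≡fromOutside∨fromInside : ∀ {n} (a : Arcs n) (S : Subset n) x y →
                               a x y ≡ (lookup (∁ S) x ∧ a x y) ∨ (lookup S x ∧ a x y)
  arc≡fromOutside∨fromInside a S x y rewrite lookup∁ S x with lookup S x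
  ... | true  = refl
  ... | false = sym (∨-identityʳ (a x y))

  squeeze : ∀ {s c d} → c + 1 ≤ s → d ≤ s + c → 2 * s ≡ d + 1 → s ≡ suc c × d ≡ 2 * c + 1
  squeeze {s} {c} {d} c<s d≤s+c 2s≡d+1 = s≡suc-c , d≡2c+1
    where
    s≤suc-c : s ≤ suc c
    s≤suc-c = +-cancelˡ-≤ s s (suc c) (begin
      s + s         ≡⟨ cong (_+_ s) (+-identityʳ s) ⟨
      2 * s         ≡⟨ 2s≡d+1 ⟩
      d + 1         ≤⟨ +-monoˡ-≤ 1 d≤s+c ⟩
      s + c + 1     ≡⟨ +-assoc s c 1 ⟩
      s + (c + 1)   ≡⟨ cong (_+_ s) (+-comm c 1) ⟩
      s + suc c     ∎)
      where open ≤-Reasoning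
    s≡suc-c : s ≡ suc c
    s≡suc-c = ≤-antisym s≤suc-c (subst (_≤ s) (+-comm c 1) c<s)
    d≡2c+1 : d ≡ 2 * c + 1
    d≡2c+1 = +-cancelʳ-≡ 1 d (2 * c + 1)
      (trans (sym 2s≡d+1) (trans (cong (2 *_) s≡suc-c) (double-suc c)))
      where
      double-suc : ∀ c → 2 * suc c ≡ 2 * c + 1 + 1
      double-suc = solve-∀

  module TightAlliance {n} (D : Digraph n) {S : Subset n}
    (alliance : IsGlobalOffensiveAlliance D (+ 1) S)
    (tight : ∣ S ∣ * (2 * Δ⁺ D + δ⁻ D + 1) ≡ (1 + δ⁻ D) * n) where

    private
      a : Arcs n
      a  = arc D
      Δ δ m n₁ : ℕ
      Δ  = Δ⁺ D
      δ  = δ⁻ D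
      m  = ∣ S ∣
      n₁ = ∣ ∁ S ∣
      dS dC : Fin n → ℕ
      dS = degInFrom a S
      dC = degInFrom a (∁ S)

    2mΔ≡n₁[δ+1] : 2 * (m * Δ) ≡ n₁ * (δ + 1)
    2mΔ≡n₁[δ+1] = +-cancelʳ-≡ (m * (δ + 1)) _ _ (begin
      2 * (m * Δ) + m * (δ + 1)   ≡⟨ expand-lhs m Δ δ ⟩
      m * (2 * Δ + δ + 1)         ≡⟨ tight ⟩
      (1 + δ) * n                 ≡⟨ cong (_*_ (1 + δ)) (∣p∣+∣∁p∣≡n S) ⟨
      (1 + δ) * (m + n₁)          ≡⟨ expand-rhs m n₁ δ ⟩
      n₁ * (δ + 1) + m * (δ + 1)  ∎)
      where
      open ≡-Reasoning
      expand-lhs : ∀ m Δ δ → 2 * (m * Δ) + m * (δ + 1) ≡ m * (2 * Δ + δ + 1)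
      expand-lhs = solve-∀
      expand-rhs : ∀ m n₁ δ → (1 + δ) * (m + n₁) ≡ n₁ * (δ + 1) + m * (δ + 1)
      expand-rhs = solve-∀

    private
      δ+1≤2dS : ∀ v → lookup (∁ S) v ≡ true → δ + 1 ≤ 2 * dS v
      δ+1≤2dS v v∉S = ℤₚ.drop‿+≤+ (alliance⇒δ⁻+k≤2*degInFrom D {+ 1} alliance v (lookup∁⇒∉ v∉S))

      ∑outside-const : sumWhere (lookup (∁ S)) (λ _ → δ + 1) ≡ 2 * (m * Δ)
      ∑outside-const = begin
        sumWhere (lookup (∁ S)) (λ _ → δ + 1)  ≡⟨ sumWhere-const (lookup (∁ S)) (δ + 1) ⟩
        count (lookup (∁ S)) * (δ + 1)         ≡⟨ cong (_* (δ + 1)) (∣p∣≡count (∁ S)) ⟨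
        n₁ * (δ + 1)                           ≡⟨ 2mΔ≡n₁[δ+1] ⟨
        2 * (m * Δ)                            ∎
        where open ≡-Reasoning

    2*degInFrom-outside : ∀ v → v ∉ S → 2 * dS v ≡ δ + 1
    2*degInFrom-outside v v∉S =
      sym (sumWhere-mono-tight (lookup (∁ S)) δ+1≤2dS ∑≤ v (∉⇒lookup∁ v∉S))
      where
      open ≤-Reasoning
      ∑≤ : sumWhere (lookup (∁ S)) (λ v → 2 * dS v) ≤ sumWhere (lookup (∁ S)) (λ _ → δ + 1)
      ∑≤ = begin
        sumWhere (lookup (∁ S)) (λ v → 2 * dS v)  ≡⟨ 2*crossArcs≡∑2degInFrom D S ⟨
        2 * crossArcs D S                         ≤⟨ *-monoʳ-≤ 2 (crossArcs≤∣S∣*Δ⁺ D S) ⟩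
        2 * (m * Δ)                               ≡⟨ ∑outside-const ⟨
        sumWhere (lookup (∁ S)) (λ _ → δ + 1)     ∎

    outDegTo∁-inside : ∀ u → u ∈ S → outDegTo a (∁ S) u ≡ Δ
    outDegTo∁-inside u u∈S =
      sumWhere-mono-tight (lookup S) (λ u _ → outDegTo≤Δ⁺ D (∁ S) u) ∑≤ u ([]=⇒lookup u∈S)
      where
      open ≤-Reasoning
      2mΔ≤2E : 2 * (m * Δ) ≤ 2 * crossArcs D S
      2mΔ≤2E = begin
        2 * (m * Δ)                                ≡⟨ ∑outside-const ⟨
        sumWhere (lookup (∁ S)) (λ _ → δ + 1)      ≤⟨ sumWhere-mono (lookup (∁ S)) δ+1≤2dS ⟩
        sumWhere (lookup (∁ S)) (λ v → 2 * dS v)   ≡⟨ 2*crossArcs≡∑2degInFrom D S ⟨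
        2 * crossArcs D S                          ∎
      ∑≤ : sumWhere (lookup S) (λ _ → Δ) ≤ crossArcs D S
      ∑≤ = begin
        sumWhere (lookup S) (λ _ → Δ)  ≡⟨ sumWhere-const (lookup S) Δ ⟩
        count (lookup S) * Δ           ≡⟨ cong (_* Δ) (∣p∣≡count S) ⟨
        m * Δ                          ≤⟨ *-cancelˡ-≤ 2 2mΔ≤2E ⟩
        crossArcs D S                  ∎

    degInFrom-outside : ∀ v → v ∉ S → dS v ≡ suc (dC v) × δ ≡ 2 * dC v + 1
    degInFrom-outside v v∉S = squeeze (ℤₚ.drop‿+≤+ (proj₂ alliance v v∉S))
      (δ⁻≤degInFrom+degInFrom∁ D S v) (2*degInFrom-outside v v∉S)

    outDeg-inside : ∀ u → u ∈ S → outDeg a u ≡ Δ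
    outDeg-inside u u∈S = ≤-antisym (maxF-ub (outDeg a) u)
      (subst (_≤ outDeg a u) (outDegTo∁-inside u u∈S) (outDegTo≤outDeg a (∁ S) u))

    arc-from-inside : ∀ {u w} → u ∈ S → a u w ≡ true → w ∉ S
    arc-from-inside {u} {w} u∈S uw = lookup∁⇒∉ (∧-conicalˡ _ _
      (count-mono-tight (λ v → ∧-conicalʳ (lookup (∁ S) v) (a u v))
        (≤-reflexive (trans (outDeg-inside u u∈S) (sym (outDegTo∁-inside u u∈S)))) w uw))

    -- Some arc is needed: in an arcless digraph S = V is extremal, yet D ∉ Φ.
    ∃outside : 0 < Δ⁻ D → ∃ λ v → v ∉ S
    ∃outside 0<Δ⁻ with ∃arc D 0<Δ⁻
    ... | u , w , uw with u ∈? S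
    ...   | yes u∈S = w , arc-from-inside u∈S uw
    ...   | no  u∉S = u , u∉S

    module _ (0<Δ⁻ : 0 < Δ⁻ D) where

      private
        v₀ : Fin n
        v₀ = proj₁ (∃outside 0<Δ⁻)
        v₀∉S : v₀ ∉ S
        v₀∉S = proj₂ (∃outside 0<Δ⁻)

      r' : ℕ
      r' = dC v₀

      δ≡2r'+1 : δ ≡ 2 * r' + 1
      δ≡2r'+1 = proj₂ (degInFrom-outside v₀ v₀∉S)

      degInFrom∁-outside≡r' : ∀ v → v ∉ S → dC v ≡ r'
      degInFrom∁-outside≡r' v v∉S = *-cancelˡ-≡ (dC v) r' 2
        (+-cancelʳ-≡ 1 (2 * dC v) (2 * r') (trans (sym (proj₂ (degInFrom-outside v v∉S))) δ≡2r'+1))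

      degInFrom-outside≡suc-r' : ∀ v → v ∉ S → dS v ≡ suc r'
      degInFrom-outside≡suc-r' v v∉S = trans (proj₁ (degInFrom-outside v v∉S)) (cong suc (degInFrom∁-outside≡r' v v∉S))

      Δm≡[r'+1]n₁ : Δ * m ≡ suc r' * n₁
      Δm≡[r'+1]n₁ = *-cancelˡ-≡ (Δ * m) (suc r' * n₁) 2 (begin
        2 * (Δ * m)           ≡⟨ cong (2 *_) (*-comm Δ m) ⟩
        2 * (m * Δ)           ≡⟨ 2mΔ≡n₁[δ+1] ⟩
        n₁ * (δ + 1)          ≡⟨ cong (λ x → n₁ * (x + 1)) δ≡2r'+1 ⟩
        n₁ * (2 * r' + 1 + 1) ≡⟨ regroup n₁ r' ⟩
        2 * (suc r' * n₁)     ∎)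
        where
        open ≡-Reasoning
        regroup : ∀ n₁ r' → n₁ * (2 * r' + 1 + 1) ≡ 2 * (suc r' * n₁)
        regroup = solve-∀

      inΦ : InΦ D
      inΦ = record
        { U      = S
        ; n'≥1   = x∈p⇒∣p∣>0 (x∉p⇒x∈∁p v₀∉S)
        ; p≥1    = ≤-trans (s≤s z≤n) (subst (_≤ m) (degInFrom-outside≡suc-r' v₀ v₀∉S) (degInFrom≤∣S∣ a S v₀))
        ; r'     = r'
        ; r      = Δ
        ; r-def  = Δm≡[r'+1]n₁
        ; Dhat   = fromOutside
        ; A      = λ x y → lookup S x ∧ a x y
        ; out-v  = λ v _ → ≤-trans (count-mono (λ w → ∧-conicalʳ (lookup (∁ S) v) (a v w))) (maxF-ub (outDeg a) v)
        ; in-v   = λ v v∉S → trans (count-cong (λ u → ∧-absorb (lookup (∁ S) u) (a u v))) (degInFrom∁-outside≡r' v v∉S)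
        ; out-u  = λ u u∈S → count-none _ (λ w → cong (_∧ a u w) (∈⇒lookup∁ u∈S))
        ; in-u   = λ u u∈S → ≤-trans (≤-reflexive (sym δ≡2r'+1))
                               (≤-trans (minF-lb (inDeg a) u) (count-mono (arc-into-inside u∈S)))
        ; A-from = λ x y xy → let x∈S = lookup⇒[]= x S (∧-conicalˡ (lookup S x) (a x y) xy)
                             in x∈S , arc-from-inside x∈S (∧-conicalʳ (lookup S x) (a x y) xy)
        ; A-out  = λ u u∈S → trans (count-cong (λ w → cong (_∧ a u w) ([]=⇒lookup u∈S))) (outDeg-inside u u∈S)
        ; A-in   = degInFrom-outside≡suc-r'
        ; D-eq   = arc≡fromOutside∨fromInside a S
        }
        where
        fromOutside : Digraph n
        fromOutside = record
          { arc      = λ x y → lookup (∁ S) x ∧ a x y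
          ; loopless = λ x → trans (cong (lookup (∁ S) x ∧_) (loopless D x)) (∧-zeroʳ (lookup (∁ S) x))
          }
        ∧-absorb : ∀ b c → b ∧ (b ∧ c) ≡ b ∧ c
        ∧-absorb b c = trans (sym (∧-assoc b b c)) (cong (_∧ c) (∧-idem b))
        arc-into-inside : ∀ {u} → u ∈ S → ∀ x → a x u ≡ true → lookup (∁ S) x ∧ a x u ≡ true
        arc-into-inside u∈S x xu =
          cong₂ _∧_ (∉⇒lookup∁ (λ x∈S → arc-from-inside x∈S xu u∈S)) xu

  module FamilyΦ {n} {D : Digraph n} (φ : InΦ D) where

    open InΦ φ

    private
      a : Arcs n
      a = arc D

    arc-from-U : ∀ {u} → u ∈ U → ∀ y → a u y ≡ A u y
    arc-from-U {u} u∈U y = trans (D-eq u y) (cong (_∨ A u y) (count≡0⇒none (arc Dhat u) (out-u u u∈U) y))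

    arc-from-∁U : ∀ {x} → x ∉ U → ∀ y → a x y ≡ arc Dhat x y
    arc-from-∁U {x} x∉U y with A x y in xy
    ... | true  = ⊥-elim (x∉U (proj₁ (A-from x y xy)))
    ... | false = trans (D-eq x y) (trans (cong (arc Dhat x y ∨_) xy) (∨-identityʳ (arc Dhat x y)))

    Δ⁺≡r : Δ⁺ D ≡ r
    Δ⁺≡r = ≤-antisym (maxF-lub (outDeg a) outDeg≤r) (subst (_≤ Δ⁺ D) (outDeg-U u₀∈U) (maxF-ub (outDeg a) u₀))
      where
      outDeg-U : ∀ {u} → u ∈ U → outDeg a u ≡ r
      outDeg-U {u} u∈U = trans (count-cong (arc-from-U u∈U)) (A-out u u∈U)
      outDeg≤r : ∀ x → outDeg a x ≤ r
      outDeg≤r x with x ∈? U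
      ... | yes x∈U = ≤-reflexive (outDeg-U x∈U)
      ... | no  x∉U = ≤-trans (≤-reflexive (count-cong (arc-from-∁U x∉U))) (out-v x x∉U)
      u₀ : Fin n
      u₀ = proj₁ (∣p∣>0⇒Nonempty U p≥1)
      u₀∈U : u₀ ∈ U
      u₀∈U = proj₂ (∣p∣>0⇒Nonempty U p≥1)

    degInFrom-U : ∀ v → v ∉ U → degInFrom a U v ≡ suc r'
    degInFrom-U v v∉U = trans (count-cong inside) (A-in v v∉U)
      where
      inside : ∀ x → lookup U x ∧ a x v ≡ A x v
      inside x with x ∈? U
      ... | yes x∈U = trans (cong (_∧ a x v) ([]=⇒lookup x∈U)) (arc-from-U x∈U v)
      ... | no  x∉U with A x v in xv
      ...   | true  = ⊥-elim (x∉U (proj₁ (A-from x v xv)))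
      ...   | false = cong (_∧ a x v) (∉⇒lookup x∉U)

    degInFrom-∁U : ∀ v → v ∉ U → degInFrom a (∁ U) v ≡ r'
    degInFrom-∁U v v∉U = trans (count-cong outside) (in-v v v∉U)
      where
      outside : ∀ x → lookup (∁ U) x ∧ a x v ≡ lookup (∁ U) x ∧ arc Dhat x v
      outside x with x ∈? U
      ... | yes x∈U rewrite ∈⇒lookup∁ x∈U = refl
      ... | no  x∉U = cong (lookup (∁ U) x ∧_) (arc-from-∁U x∉U v)

    U-alliance : IsGlobalOffensiveAlliance D (+ 1) U
    U-alliance = dominating , outnumbered
      where
      dominating : ∀ v → v ∈ U ⊎ ∃ λ u → u ∈ U × a u v ≡ true
      dominating v with v ∈? U
      ... | yes v∈U = inj₁ v∈U
      ... | no  v∉U with count-pos⇒∃ (λ x → A x v) (subst (0 <_) (sym (A-in v v∉U)) (s≤s z≤n))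
      ...   | x , xv = inj₂ (x , proj₁ (A-from x v xv) , trans (arc-from-U (proj₁ (A-from x v xv)) v) xv)
      outnumbered : ∀ v → v ∉ U → + degInFrom a (∁ U) v ℤ.+ + 1 ℤ.≤ + degInFrom a U v
      outnumbered v v∉U = ℤ.+≤+ (≤-reflexive (begin
        degInFrom a (∁ U) v + 1  ≡⟨ cong (_+ 1) (degInFrom-∁U v v∉U) ⟩
        r' + 1                   ≡⟨ +-comm r' 1 ⟩
        suc r'                   ≡⟨ degInFrom-U v v∉U ⟨
        degInFrom a U v          ∎))
        where open ≡-Reasoning

    inDeg-∁U : ∀ v → v ∉ U → inDeg a v ≡ 2 * r' + 1
    inDeg-∁U v v∉U = begin
      inDeg a v                              ≡⟨ inDeg≡degInFrom+degInFrom∁ a U v ⟩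
      degInFrom a U v + degInFrom a (∁ U) v  ≡⟨ cong₂ _+_ (degInFrom-U v v∉U) (degInFrom-∁U v v∉U) ⟩
      suc r' + r'                            ≡⟨ regroup r' ⟩
      2 * r' + 1                             ∎
      where
      open ≡-Reasoning
      regroup : ∀ r' → suc r' + r' ≡ 2 * r' + 1
      regroup = solve-∀

    δ⁻≡2r'+1 : δ⁻ D ≡ 2 * r' + 1
    δ⁻≡2r'+1 = ≤-antisym (subst (δ⁻ D ≤_) (inDeg-∁U v₀ v₀∉U) (minF-lb (inDeg a) v₀))
                         (minF-glb (inDeg a) v₀ lower)
      where
      v₀ : Fin n
      v₀ = proj₁ (∣p∣>0⇒Nonempty (∁ U) n'≥1)
      v₀∉U : v₀ ∉ U
      v₀∉U = x∈∁p⇒x∉p (proj₂ (∣p∣>0⇒Nonempty (∁ U) n'≥1))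
      lower : ∀ x → 2 * r' + 1 ≤ inDeg a x
      lower x with x ∈? U
      ... | yes x∈U = ≤-trans (in-u x x∈U) (count-mono (λ y yx → trans (D-eq y x) (cong (_∨ A y x) yx)))
      ... | no  x∉U = ≤-reflexive (sym (inDeg-∁U x x∉U))

    size-identity : (1 + δ⁻ D) * n ≡ ∣ U ∣ * (2 * Δ⁺ D + δ⁻ D + 1)
    size-identity rewrite Δ⁺≡r | δ⁻≡2r'+1 = begin
      (1 + (2 * r' + 1)) * n                       ≡⟨ cong (_*_ (1 + (2 * r' + 1))) (∣p∣+∣∁p∣≡n U) ⟨
      (1 + (2 * r' + 1)) * (p + n')                ≡⟨ expand p n' r' ⟩
      (1 + (2 * r' + 1)) * p + 2 * (suc r' * n')   ≡⟨ cong (λ x → (1 + (2 * r' + 1)) * p + 2 * x) r-def ⟨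
      (1 + (2 * r' + 1)) * p + 2 * (r * p)         ≡⟨ collect p r r' ⟩
      p * (2 * r + (2 * r' + 1) + 1)               ∎
      where
      open ≡-Reasoning
      p n' : ℕ
      p  = ∣ U ∣
      n' = ∣ ∁ U ∣
      expand : ∀ p n' r' → (1 + (2 * r' + 1)) * (p + n') ≡ (1 + (2 * r' + 1)) * p + 2 * (suc r' * n')
      expand = solve-∀
      collect : ∀ p r r' → (1 + (2 * r' + 1)) * p + 2 * (r * p) ≡ p * (2 * r + (2 * r' + 1) + 1)
      collect = solve-∀

    γ-equality : ∀ {m} → IsGammaO D (+ 1) m → m * (2 * Δ⁺ D + δ⁻ D + 1) ≡ (1 + δ⁻ D) * n
    γ-equality {m} ((S , S-alliance , ∣S∣≡m) , minimal) = begin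
      m * K            ≡⟨ cong (_* K) m≡p ⟩
      ∣ U ∣ * K        ≡⟨ size-identity ⟨
      (1 + δ⁻ D) * n   ∎
      where
      open ≡-Reasoning
      K : ℕ
      K = 2 * Δ⁺ D + δ⁻ D + 1
      instance
        K-nonZero : NonZero K
        K-nonZero = >-nonZero (subst (0 <_) (+-comm 1 (2 * Δ⁺ D + δ⁻ D)) (s≤s z≤n))
      p*K≤m*K : ∣ U ∣ * K ≤ m * K
      p*K≤m*K = subst₂ _≤_ size-identity (cong (_* K) ∣S∣≡m) (alliance-size-bound₁ D S-alliance)
      m≡p : m ≡ ∣ U ∣
      m≡p = ≤-antisym (minimal U U-alliance) (*-cancelʳ-≤ ∣ U ∣ m K p*K≤m*K)

open Alliance
open import Data.Nat using (ℕ)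
open import Data.Integer using (ℤ; +_; _+_; _-_; _*_; _≤_; _≥_)
open import Data.Fin.Subset using (∣_∣)
open import Data.Product using (_×_; _,_)
open import Function.Bundles using (_⇔_; mk⇔; Equivalence)
open import Relation.Binary.PropositionalEquality using (_≡_; refl)

theorem3 : ∀ {n : ℕ} (D : Digraph n) (k : ℤ) →
    + 2 - + Δ⁻ D ≤ k → k ≤ + Δ⁻ D →
    (m : ℕ) → IsGammaO D k m →
    (+ m * (+ 2 * + Δ⁺ D + + δ⁻ D + k) ≥ (k + + δ⁻ D) * + n)
    × (k ≡ + 1 → ((+ m * (+ 2 * + Δ⁺ D + + δ⁻ D + k) ≡ (k + + δ⁻ D) * + n) ⇔ InΦ D))
theorem3 {n} D k 2-Δ⁻≤k _ _ γ@((S , S-alliance , refl) , _) =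
  alliance-size-bound D S-alliance , equality-case
  where
  equality-case : k ≡ + 1 → (+ ∣ S ∣ * (+ 2 * + Δ⁺ D + + δ⁻ D + k) ≡ (k + + δ⁻ D) * + n) ⇔ InΦ D
  equality-case refl = mk⇔
    (λ tight → TightAlliance.inΦ D S-alliance (Equivalence.to (ℤ-equation₁⇔ℕ ∣ S ∣ n (Δ⁺ D) (δ⁻ D)) tight)
                                  (2-x≤1⇒0<x (Δ⁻ D) 2-Δ⁻≤k))
    (λ φ → Equivalence.from (ℤ-equation₁⇔ℕ ∣ S ∣ n (Δ⁺ D) (δ⁻ D)) (FamilyΦ.γ-equality φ γ))
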